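{- Let $d\ge 2$ be an integer, let $\Delta\ge 1$, and let $G$ be a graph of maximum degree at most $\Delta$ containing a vertex $v$ such that every vertex of $G$ is at distance at most $\lceil d/2\rceil$ from $v$. Then every $d$-scattered set of $G$ has size at most $\Delta$.
   Context: Graphs are finite, simple, undirected; $d_G(u,w)$ denotes shortest-path distance. A $d$-scattered set of $G$ is a set $K\subseteq V(G)$ with $d_G(u,w)\ge d$ for all distinct $u,w\in K$. -}

module Defs where

open import Data.Nat.Base using (ℕ; zero; suc; _≤_; _<_)
open import Data.Bool.Base using (Bool; true; false)
open import Data.Fin.Base using (Fin)
open import Data.Fin.Subset using (Subset; _∈_; ∣_∣)
open import Data.Vec.Base using (tabulate)
open import Data.Product.Base using (∃; _×_)
open import Relation.Binary.PropositionalEquality using (_≡_; _≢_)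
open import Relation.Nullary using (¬_)

record Graph (n : ℕ) : Set where
  field
    adj     : Fin n → Fin n → Bool
    symm    : ∀ u w → adj u w ≡ adj w u
    irrefl  : ∀ u → adj u u ≡ false

open Graph public

data Walk {n : ℕ} (G : Graph n) : Fin n → Fin n → ℕ → Set where
  nil  : ∀ {u} → Walk G u u zero
  cons : ∀ {u w x k} → adj G u w ≡ true → Walk G w x k → Walk G u x (suc k)

-- d_G(u,w) ≤ k  (there is a walk, equivalently a path, of length ≤ k)
DistLe : ∀ {n} → Graph n → Fin n → Fin n → ℕ → Set
DistLe G u w k = ∃ λ j → j ≤ k × Walk G u w j

-- d_G(u,w) ≥ d  (no walk of length < d; includes d_G = ∞)
DistGe : ∀ {n} → Graph n → Fin n → Fin n → ℕ → Set
DistGe G u w d = ¬ (∃ λ j → j < d × Walk G u w j)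

degree : ∀ {n} → Graph n → Fin n → ℕ
degree G v = ∣ tabulate (adj G v) ∣

MaxDegreeAtMost : ∀ {n} → Graph n → ℕ → Set
MaxDegreeAtMost G Δ = ∀ v → degree G v ≤ Δ

Scattered : ∀ {n} → Graph n → ℕ → Subset n → Set
Scattered G d K = ∀ u w → u ∈ K → w ∈ K → u ≢ w → DistGe G u w d

module Submission where

-- Write d = 2 + d' and c = ⌈d'/2⌉, so ⌈d/2⌉ = 1 + c
-- and c + c < d.  Let K be d-scattered.
--   * If v ∈ K, every u ∈ K is within ⌈d/2⌉ < d of v, hence u = v and ∣K∣ ≤ 1 ≤ Δ.
--   * If v ∉ K, send each u ∈ K to the first vertex after v on a walk of
--     length ≤ 1 + c from v to u.  This is a neighbour of v lying within c of u;
--     two members of K with the same image are within c + c < d of each other,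
--     so they coincide.  An injection of K into the neighbourhood of v gives
--     ∣K∣ ≤ degree v ≤ Δ.

open import Defs
open import Data.Nat.Base using (ℕ; zero; suc; _+_; _≤_; _<_; z≤n; s≤s; ⌈_/2⌉)
open import Data.Nat.Properties
  using (≤-refl; ≤-reflexive; ≤-trans; <-≤-trans; ≤-<-trans; ≤-pred; n≤1+n; +-suc; +-mono-≤; n≮0; ⌈n/2⌉<n)
open import Data.Bool.Base using (true)
open import Data.Fin.Base as F using (Fin)
open import Data.Fin.Properties using (_≟_)
open import Data.Fin.Subset
  using (Subset; _∈_; _∉_; _⊆_; _─_; _-_; ⁅_⁆; ⊥; ∣_∣; Nonempty; inside; outside)
open import Data.Fin.Subset.Properties
  using (_∈?_; nonempty?; Empty-unique; ∣⊥∣≡0; p─⊥≡p; p─q⊆p; x∈p∧x≢y⇒x∈p-y;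
         x∈p⇒∣p-x∣<∣p∣; x∈⁅x⁆; ∣⁅x⁆∣≡1; p⊆q⇒∣p∣≤∣q∣)
open import Data.Vec.Base using (_∷_; tabulate; there)
open import Data.Vec.Properties using (lookup⇒[]=; lookup∘tabulate)
open import Data.Product.Base using (∃; _×_; _,_; proj₁; proj₂)
open import Relation.Binary.PropositionalEquality
  using (_≡_; _≢_; refl; sym; trans; subst; cong)
open import Relation.Nullary using (yes; no; contradiction)

∣p∣≤∣p─⊥∣ : ∀ {n} (p : Subset n) → ∣ p ∣ ≤ ∣ p ─ ⊥ ∣
∣p∣≤∣p─⊥∣ p = ≤-reflexive (cong ∣_∣ (sym (p─⊥≡p p)))

∣p∣≤1+∣p-x∣ : ∀ {n} (p : Subset n) (x : Fin n) → ∣ p ∣ ≤ suc ∣ p - x ∣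
∣p∣≤1+∣p-x∣ (inside  ∷ p) F.zero    = s≤s (∣p∣≤∣p─⊥∣ p)
∣p∣≤1+∣p-x∣ (outside ∷ p) F.zero    = ≤-trans (∣p∣≤∣p─⊥∣ p) (n≤1+n _)
∣p∣≤1+∣p-x∣ (inside  ∷ p) (F.suc x) = s≤s (∣p∣≤1+∣p-x∣ p x)
∣p∣≤1+∣p-x∣ (outside ∷ p) (F.suc x) = ∣p∣≤1+∣p-x∣ p x

x∉p-x : ∀ {n} (p : Subset n) (x : Fin n) → x ∉ p - x
x∉p-x (s ∷ p) F.zero    ()
x∉p-x (s ∷ p) (F.suc x) (there x∈p-x) = x∉p-x p x x∈p-x

nonempty-of-size : ∀ {n} (p : Subset n) → 0 < ∣ p ∣ → Nonempty p
nonempty-of-size {n} p 0<∣p∣ with nonempty? p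
... | yes p-nonempty = p-nonempty
... | no  p-empty    = contradiction 0<∣⊥∣ n≮0
  where
  0<∣⊥∣ : 0 < 0
  0<∣⊥∣ = subst (0 <_) (∣⊥∣≡0 n) (subst (λ q → 0 < ∣ q ∣) (Empty-unique p-empty) 0<∣p∣)

module _ {n m : ℕ} where

  -- Every lower bound on ∣ K ∣ is one on ∣ N ∣: delete some x from K and f x
  -- from N, and recurse on the restricted injection.
  injection-transfers-bounds :
    (k : ℕ) (K : Subset n) (N : Subset m) (f : ∀ {u} → u ∈ K → Fin m) →
    (∀ {u} (u∈K : u ∈ K) → f u∈K ∈ N) →
    (∀ {u w} (u∈K : u ∈ K) (w∈K : w ∈ K) → f u∈K ≡ f w∈K → u ≡ w) →
    k ≤ ∣ K ∣ → k ≤ ∣ N ∣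
  injection-transfers-bounds zero    K N f maps-into injective k≤∣K∣ = z≤n
  injection-transfers-bounds (suc k) K N f maps-into injective k<∣K∣
    with nonempty-of-size K (<-≤-trans (s≤s z≤n) k<∣K∣)
  ... | x , x∈K = <-≤-trans (s≤s k≤∣N'∣) (x∈p⇒∣p-x∣<∣p∣ (maps-into x∈K))
    where
    K' = K - x
    N' = N - f x∈K
    restrict : ∀ {u} → u ∈ K' → u ∈ K
    restrict = p─q⊆p K ⁅ x ⁆
    f' : ∀ {u} → u ∈ K' → Fin m
    f' u∈K' = f (restrict u∈K')
    maps-into' : ∀ {u} (u∈K' : u ∈ K') → f' u∈K' ∈ N'
    maps-into' {u} u∈K' = x∈p∧x≢y⇒x∈p-y (maps-into (restrict u∈K')) fu≢fx
      where
      fu≢fx : f' u∈K' ≢ f x∈K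
      fu≢fx fu≡fx = x∉p-x K x (subst (_∈ K') (injective (restrict u∈K') x∈K fu≡fx) u∈K')
    injective' : ∀ {u w} (u∈K' : u ∈ K') (w∈K' : w ∈ K') → f' u∈K' ≡ f' w∈K' → u ≡ w
    injective' u∈K' w∈K' = injective (restrict u∈K') (restrict w∈K')
    k≤∣N'∣ : k ≤ ∣ N' ∣
    k≤∣N'∣ = injection-transfers-bounds k K' N' f' maps-into' injective'
               (≤-pred (≤-trans k<∣K∣ (∣p∣≤1+∣p-x∣ K x)))

  injection-size :
    (K : Subset n) (N : Subset m) (f : ∀ {u} → u ∈ K → Fin m) →
    (∀ {u} (u∈K : u ∈ K) → f u∈K ∈ N) →
    (∀ {u w} (u∈K : u ∈ K) (w∈K : w ∈ K) → f u∈K ≡ f w∈K → u ≡ w) →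
    ∣ K ∣ ≤ ∣ N ∣
  injection-size K N f maps-into injective =
    injection-transfers-bounds ∣ K ∣ K N f maps-into injective ≤-refl

module _ {n : ℕ} (G : Graph n) where

  _++ʷ_ : ∀ {u x w a b} → Walk G u x a → Walk G x w b → Walk G u w (a + b)
  nil      ++ʷ q = q
  cons e p ++ʷ q = cons e (p ++ʷ q)

  snoc : ∀ {u w x k} → Walk G u w k → adj G w x ≡ true → Walk G u x (suc k)
  snoc nil        e = cons e nil
  snoc (cons e p) f = cons e (snoc p f)

  reverse : ∀ {u w k} → Walk G u w k → Walk G w u k
  reverse nil                = nil
  reverse (cons {u} {y} e p) = snoc (reverse p) (trans (symm G y u) e)

  dist-sym : ∀ {u w k} → DistLe G u w k → DistLe G w u k
  dist-sym (j , j≤k , p) = j , j≤k , reverse p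

  dist-triangle : ∀ {u x w a b} → DistLe G u x a → DistLe G x w b → DistLe G u w (a + b)
  dist-triangle (i , i≤a , p) (j , j≤b , q) = i + j , +-mono-≤ i≤a j≤b , p ++ʷ q

  first-step : ∀ {v u c} → DistLe G v u (suc c) → u ≢ v →
               ∃ λ x → adj G v x ≡ true × DistLe G x u c
  first-step (zero  , _       , nil)      u≢v = contradiction refl u≢v
  first-step (suc j , s≤s j≤c , cons e p) _   = _ , e , j , j≤c , p

  scattered-close⇒equal : ∀ {d K u w k} → Scattered G d K → u ∈ K → w ∈ K →
                          DistLe G u w k → k < d → u ≡ w
  scattered-close⇒equal {u = u} {w} scattered u∈K w∈K (j , j≤k , p) k<d with u ≟ w
  ... | yes u≡w = u≡w
  ... | no  u≢w = contradiction (j , ≤-<-trans j≤k k<d , p) (scattered u w u∈K w∈K u≢w)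

  neighbour∈ : ∀ {v x} → adj G v x ≡ true → x ∈ tabulate (adj G v)
  neighbour∈ {v} {x} e = lookup⇒[]= x _ (trans (lookup∘tabulate (adj G v) x) e)

  -- Case v ∈ K: all of K lies within radius r < d of the member v, so K ⊆ ⁅ v ⁆.
  scattered-size-centre-in : ∀ {d r v K} → Scattered G d K → r < d →
    (∀ u → DistLe G v u r) → v ∈ K → ∣ K ∣ ≤ 1
  scattered-size-centre-in {v = v} {K} scattered r<d v-centre v∈K =
    subst (∣ K ∣ ≤_) (∣⁅x⁆∣≡1 v) (p⊆q⇒∣p∣≤∣q∣ K⊆⁅v⁆)
    where
    K⊆⁅v⁆ : K ⊆ ⁅ v ⁆
    K⊆⁅v⁆ {u} u∈K =
      subst (_∈ ⁅ v ⁆) (scattered-close⇒equal scattered v∈K u∈K (v-centre u) r<d) (x∈⁅x⁆ v)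

  -- Case v ∉ K with radius 1 + c and c + c < d: first steps of walks from v
  -- inject K into the neighbourhood of v.
  scattered-size-centre-out : ∀ {d c v K} → Scattered G d K → c + c < d →
    (∀ u → DistLe G v u (suc c)) → v ∉ K → ∣ K ∣ ≤ degree G v
  scattered-size-centre-out {c = c} {v} {K} scattered c+c<d v-centre v∉K =
    injection-size K (tabulate (adj G v)) towards (λ u∈K → neighbour∈ (adjacent u∈K)) injective
    where
    step : ∀ {u} → u ∈ K → ∃ λ x → adj G v x ≡ true × DistLe G x u c
    step {u} u∈K = first-step (v-centre u) λ { refl → v∉K u∈K }
    towards : ∀ {u} → u ∈ K → Fin n
    towards u∈K = proj₁ (step u∈K)
    adjacent : ∀ {u} (u∈K : u ∈ K) → adj G v (towards u∈K) ≡ true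
    adjacent u∈K = proj₁ (proj₂ (step u∈K))
    near : ∀ {u} (u∈K : u ∈ K) → DistLe G (towards u∈K) u c
    near u∈K = proj₂ (proj₂ (step u∈K))
    injective : ∀ {u w} (u∈K : u ∈ K) (w∈K : w ∈ K) → towards u∈K ≡ towards w∈K → u ≡ w
    injective u∈K w∈K same = scattered-close⇒equal scattered u∈K w∈K
      (dist-triangle (dist-sym (near u∈K)) (subst (λ x → DistLe G x _ c) (sym same) (near w∈K)))
      c+c<d

⌈n/2⌉+⌈n/2⌉≤1+n : ∀ n → ⌈ n /2⌉ + ⌈ n /2⌉ ≤ suc n
⌈n/2⌉+⌈n/2⌉≤1+n zero          = z≤n
⌈n/2⌉+⌈n/2⌉≤1+n (suc zero)    = ≤-refl
⌈n/2⌉+⌈n/2⌉≤1+n (suc (suc n)) rewrite +-suc ⌈ n /2⌉ ⌈ n /2⌉ = s≤s (s≤s (⌈n/2⌉+⌈n/2⌉≤1+n n))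

-- With d = 2 + d' we have ⌈ d/2 ⌉ = 1 + ⌈ d'/2 ⌉ by computation.
lemma8 : (d Δ n : ℕ) → 2 ≤ d → 1 ≤ Δ → (G : Graph n) → MaxDegreeAtMost G Δ →
    (v : Fin n) → (∀ u → DistLe G v u ⌈ d /2⌉) →
    (K : Subset n) → Scattered G d K → ∣ K ∣ ≤ Δ
lemma8 (suc (suc d')) Δ n (s≤s (s≤s _)) 1≤Δ G max-degree v v-centre K scattered with v ∈? K
... | yes v∈K = ≤-trans (scattered-size-centre-in G scattered (⌈n/2⌉<n d') v-centre v∈K) 1≤Δ
... | no  v∉K = ≤-trans
  (scattered-size-centre-out G scattered (s≤s (⌈n/2⌉+⌈n/2⌉≤1+n d')) v-centre v∉K)
  (max-degree v)
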